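{- For every integer $a\ge 1$ and every $n\ge 2a-1$, $\mathcal{A}_{0^a,012}(n)=\emptyset$, where $0^a$ denotes the pattern consisting of $a$ zeros.
   Context: An ascent of an integer word $x_1\cdots x_n$ is an index $j$ with $x_j<x_{j+1}$; $\mathrm{asc}(x_1\cdots x_n)$ denotes the number of ascents. An ascent sequence of length $n$ is a sequence $x_1\cdots x_n$ of nonnegative integers with $x_1=0$ and $x_i\le \mathrm{asc}(x_1\cdots x_{i-1})+1$ for all $1<i\le n$. A pattern is a word $p=p_1\cdots p_k$ of nonnegative integers whose set of values is $\{0,1,\dots,m\}$ for some $m$. A word $x_1\cdots x_n$ contains $p$ if there are indices $i_1<\cdots<i_k$ such that $x_{i_1}\cdots x_{i_k}$ is order-isomorphic to $p$ (i.e. for all $s,t$, $x_{i_s}<x_{i_t}$ iff $p_s<p_t$ and $x_{i_s}=x_{i_t}$ iff $p_s=p_t$); otherwise it avoids $p$. For a list $B$ of patterns, $\mathcal{A}_B(n)$ is the set of ascent sequences of length $n$ avoiding every pattern in $B$. -}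

module Defs where

open import Data.Nat using (ℕ; zero; suc; _+_; _<_; _≤_; _<ᵇ_)
open import Data.Bool using (Bool; true; false; if_then_else_)
open import Data.List using (List; []; _∷_; length; lookup; replicate)
open import Data.List.Relation.Binary.Sublist.Propositional using (_⊆_)
open import Data.Fin using (Fin)
open import Data.Product using (∃; _×_)
open import Relation.Binary.PropositionalEquality using (_≡_)
open import Relation.Nullary using (¬_)
open import Function.Bundles using (_⇔_)

asc : List ℕ → ℕ
asc [] = 0
asc (x ∷ []) = 0
asc (x ∷ y ∷ xs) = (if x <ᵇ y then 1 else 0) + asc (y ∷ xs)

data ValidExt : List ℕ → List ℕ → Set where
  done : ∀ {p} → ValidExt p []
  step : ∀ {p x xs} → x ≤ asc p + 1 → ValidExt (p Data.List.++ (x ∷ [])) xs → ValidExt p (x ∷ xs)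

-- x_1 = 0 and x_i ≤ asc(x_1 ⋯ x_{i-1}) + 1 for 1 < i ≤ n
IsAscentSeq : List ℕ → Set
IsAscentSeq [] = Data.Unit.⊤
  where import Data.Unit
IsAscentSeq (x ∷ xs) = (x ≡ 0) × ValidExt (x ∷ []) xs

OrderIso : List ℕ → List ℕ → Set
OrderIso u p = Σ (length u ≡ length p) λ eq →
  ∀ (s t : Fin (length u)) →
    ((lookup u s < lookup u t) ⇔ (lookup p (cast eq s) < lookup p (cast eq t))) ×
    ((lookup u s ≡ lookup u t) ⇔ (lookup p (cast eq s) ≡ lookup p (cast eq t)))
  where open import Data.Product using (Σ)
        open import Data.Fin using (cast)

Contains : List ℕ → List ℕ → Set
Contains w p = ∃ λ u → (u ⊆ w) × OrderIso u p

Avoids : List ℕ → List ℕ → Set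
Avoids w p = ¬ Contains w p

p012 : List ℕ
p012 = 0 ∷ 1 ∷ 2 ∷ []

InA : ℕ → ℕ → List ℕ → Set
InA a n w = (length w ≡ n) × IsAscentSeq w × Avoids w (replicate a 0) × Avoids w p012

-- An ascent sequence avoiding 012 uses only the letters 0 and 1: its first
-- letter x ≥ 2 forces an ascent y < z before it, and z ≤ 1 since x is the
-- first large letter, so y z x is an occurrence of 012.  A word over {0,1}
-- of length at least 2a − 1 has some letter at least a times, and those
-- occurrences form a copy of 0^a.
module Submission where

open import Defs
open import Data.Nat using (ℕ; zero; suc; _+_; _∸_; _≤_; _<_; _<ᵇ_; z≤n; s≤s)
open import Data.Nat.Properties
  using (<-trans; <-irrefl; <-asym; _<?_; _≤?_; ≤-trans; ≤-reflexive;
         <ᵇ⇒<; ≰⇒>; ≮⇒≥; <⇒≱; +-mono-≤; +-suc; +-cancelʳ-≤)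
open import Data.Bool using (true; false)
open import Data.Fin using (cast) renaming (zero to fz; suc to fs)
open import Data.List using (List; []; _∷_; _++_; length; lookup; replicate)
open import Data.List.Properties using (++-assoc; ++-identityʳ; length-replicate)
open import Data.List.Relation.Unary.All as All using (All; []; _∷_)
open import Data.List.Relation.Unary.All.Properties using (replicate⁺; ++⁺)
open import Data.List.Membership.Propositional.Properties using (∈-lookup)
open import Data.List.Relation.Binary.Sublist.Propositional
  using (_⊆_; []; _∷_; _∷ʳ_; ⊆-trans; minimum)
open import Data.List.Relation.Binary.Sublist.Propositional.Properties
  using (All-resp-⊆) renaming (++⁺ to ⊆-++⁺)
open import Data.Product using (∃; ∃₂; _×_; _,_)
open import Data.Sum using (_⊎_; inj₁; inj₂)
open import Data.Empty using (⊥-elim)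
open import Function.Bundles using (_⇔_; mk⇔)
open import Relation.Nullary using (¬_; yes; no; contradiction)
open import Relation.Binary.PropositionalEquality using (_≡_; refl; sym; trans; cong; subst)

data SameOrder (a b c d : ℕ) : Set where
  both< : a < b → c < d → SameOrder a b c d
  both≡ : a ≡ b → c ≡ d → SameOrder a b c d
  both> : b < a → d < c → SameOrder a b c d

SameOrder⇒⇔ : ∀ {a b c d} → SameOrder a b c d → (a < b ⇔ c < d) × (a ≡ b ⇔ c ≡ d)
SameOrder⇒⇔ (both< a<b c<d) =
  mk⇔ (λ _ → c<d) (λ _ → a<b) ,
  mk⇔ (λ a≡b → contradiction a<b (<-irrefl a≡b)) (λ c≡d → contradiction c<d (<-irrefl c≡d))
SameOrder⇒⇔ (both≡ a≡b c≡d) =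
  mk⇔ (λ a<b → contradiction a<b (<-irrefl a≡b)) (λ c<d → contradiction c<d (<-irrefl c≡d)) ,
  mk⇔ (λ _ → c≡d) (λ _ → a≡b)
SameOrder⇒⇔ (both> b<a d<c) =
  mk⇔ (λ a<b → contradiction a<b (<-asym b<a)) (λ c<d → contradiction c<d (<-asym d<c)) ,
  mk⇔ (λ a≡b → contradiction b<a (<-irrefl (sym a≡b))) (λ c≡d → contradiction d<c (<-irrefl (sym c≡d)))

OrderIso-intro : ∀ {u p} (eq : length u ≡ length p) →
  (∀ s t → SameOrder (lookup u s) (lookup u t) (lookup p (cast eq s)) (lookup p (cast eq t))) →
  OrderIso u p
OrderIso-intro eq same = eq , λ s t → SameOrder⇒⇔ (same s t)

increasing-triple-≅-012 : ∀ {x y z} → x < y → y < z → OrderIso (x ∷ y ∷ z ∷ []) p012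
increasing-triple-≅-012 {x} {y} {z} x<y y<z = OrderIso-intro refl same
  where
  x<z : x < z
  x<z = <-trans x<y y<z
  same : ∀ s t → SameOrder _ _ _ _
  same fz           fz           = both≡ refl refl
  same fz           (fs fz)      = both< x<y (s≤s z≤n)
  same fz           (fs (fs fz)) = both< x<z (s≤s z≤n)
  same (fs fz)      fz           = both> x<y (s≤s z≤n)
  same (fs fz)      (fs fz)      = both≡ refl refl
  same (fs fz)      (fs (fs fz)) = both< y<z (s≤s (s≤s z≤n))
  same (fs (fs fz)) fz           = both> x<z (s≤s z≤n)
  same (fs (fs fz)) (fs fz)      = both> y<z (s≤s (s≤s z≤n))
  same (fs (fs fz)) (fs (fs fz)) = both≡ refl refl

lookup-replicate-≡ : ∀ n (c : ℕ) i → lookup (replicate n c) i ≡ c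
lookup-replicate-≡ n c i = All.lookup (replicate⁺ {P = _≡ c} n refl) (∈-lookup i)

replicate-≅-replicate : ∀ n (c d : ℕ) → OrderIso (replicate n c) (replicate n d)
replicate-≅-replicate n c d = OrderIso-intro {replicate n c} {replicate n d} eq λ s t →
  both≡ (trans (lookup-replicate-≡ n c s) (sym (lookup-replicate-≡ n c t)))
        (trans (lookup-replicate-≡ n d (cast eq s)) (sym (lookup-replicate-≡ n d (cast eq t))))
  where
  eq : length (replicate n c) ≡ length (replicate n d)
  eq = trans (length-replicate n) (sym (length-replicate n))

ascent⇒increasing-pair : ∀ w → 1 ≤ asc w → ∃₂ λ y z → y < z × (y ∷ z ∷ []) ⊆ w
ascent⇒increasing-pair []      ()
ascent⇒increasing-pair (x ∷ w) = from x w
  where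
  from : ∀ x w → 1 ≤ asc (x ∷ w) → ∃₂ λ y z → y < z × (y ∷ z ∷ []) ⊆ x ∷ w
  from x []      ()
  from x (y ∷ w) h with x <ᵇ y | <ᵇ⇒< x y
  ... | true  | x<y = x , y , x<y _ , refl ∷ refl ∷ minimum w
  ... | false | _ with from y w h
  ...   | u , v , u<v , uv⊆ = u , v , u<v , x ∷ʳ uv⊆

Binary : List ℕ → Set
Binary = All (_≤ 1)

ValidExt-avoiding-012-binary : ∀ {p xs} → Binary p → ValidExt p xs →
  Avoids (p ++ xs) p012 → Binary (p ++ xs)
ValidExt-avoiding-012-binary {p} bp done _ = subst Binary (sym (++-identityʳ p)) bp
ValidExt-avoiding-012-binary {p} {x ∷ xs} bp (step x≤asc+1 v) avoids with x ≤? 1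
... | yes x≤1 = subst Binary (++-assoc p (x ∷ []) xs)
      (ValidExt-avoiding-012-binary (++⁺ bp (x≤1 ∷ [])) v
        (subst (λ w → Avoids w p012) (sym (++-assoc p (x ∷ []) xs)) avoids))
... | no x≰1 with ascent⇒increasing-pair p (+-cancelʳ-≤ 1 1 (asc p) (≤-trans (≰⇒> x≰1) x≤asc+1))
...   | y , z , y<z , yz⊆p with All-resp-⊆ yz⊆p bp
...     | _ ∷ z≤1 ∷ [] = ⊥-elim (avoids
  ( y ∷ z ∷ x ∷ []
  , ⊆-++⁺ yz⊆p (refl ∷ minimum xs)
  , increasing-triple-≅-012 y<z (≤-trans (s≤s z≤1) (≰⇒> x≰1))))

ascent-seq-avoiding-012-binary : ∀ w → IsAscentSeq w → Avoids w p012 → Binary w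
ascent-seq-avoiding-012-binary []       _          _      = []
ascent-seq-avoiding-012-binary (.0 ∷ w) (refl , v) avoids =
  ValidExt-avoiding-012-binary (z≤n ∷ []) v avoids

replicate-⊆ : ∀ {k m} {c : ℕ} → k ≤ m → replicate k c ⊆ replicate m c
replicate-⊆ {m = m} z≤n = minimum (replicate m _)
replicate-⊆ (s≤s k≤m) = refl ∷ replicate-⊆ k≤m

Binary-split : ∀ {w} → Binary w →
  ∃₂ λ k m → k + m ≡ length w × replicate k 0 ⊆ w × replicate m 1 ⊆ w
Binary-split [] = 0 , 0 , refl , [] , []
Binary-split (z≤n ∷ bw) with Binary-split bw
... | k , m , k+m≡ , zeros , ones = suc k , m , cong suc k+m≡ , refl ∷ zeros , 0 ∷ʳ ones
Binary-split (s≤s z≤n ∷ bw) with Binary-split bw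
... | k , m , k+m≡ , zeros , ones =
  k , suc m , trans (+-suc k m) (cong suc k+m≡) , 1 ∷ʳ zeros , refl ∷ ones

+-<-split : ∀ {m n k l} → m + n < k + l → m < k ⊎ n < l
+-<-split {m} {n} {k} {l} m+n<k+l with m <? k
... | yes m<k = inj₁ m<k
... | no  m≮k = inj₂ (≰⇒> λ l≤n → <⇒≱ m+n<k+l (+-mono-≤ (≮⇒≥ m≮k) l≤n))

Binary-long⇒constant-subword : ∀ {a w} → Binary w → a + a < length w →
  ∃ λ c → replicate (suc a) c ⊆ w
Binary-long⇒constant-subword {a} bw a+a<len with Binary-split bw
... | k , m , k+m≡len , zeros , ones with +-<-split (subst (a + a <_) (sym k+m≡len) a+a<len)
...   | inj₁ a<k = 0 , ⊆-trans (replicate-⊆ a<k) zeros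
...   | inj₂ a<m = 1 , ⊆-trans (replicate-⊆ a<m) ones

corollary2p7 : ∀ (a n : ℕ) → 1 ≤ a → a + a ∸ 1 ≤ n → ∀ (w : List ℕ) → ¬ InA a n w
corollary2p7 zero    _ ()
corollary2p7 (suc a) _ _  2a-1≤n w (refl , ascent-seq , avoids-0ᵃ , avoids-012)
  with Binary-long⇒constant-subword
         (ascent-seq-avoiding-012-binary w ascent-seq avoids-012)
         (≤-trans (≤-reflexive (sym (+-suc a a))) 2a-1≤n)
... | c , cᵃ⊆w = avoids-0ᵃ (replicate (suc a) c , cᵃ⊆w , replicate-≅-replicate (suc a) c 0)
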